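{- Let $n\ge 2$ and let $G$ be a balanced Gray code for $\mathcal{P}^{\mathrm{all}}_n$ starting at $12\cdots(n-1)n$ and ending at $12\cdots n(n-1)$, with $c_+(G)=\{(n-1,n)\}$. Then there exists a balanced Gray code $H$ for $\mathcal{P}^{\mathrm{all}}_n$ starting at $12\cdots(n-1)n$ and ending at $213\cdots n$ (i.e. $1$ and $2$ interchanged) with $c_+(H)=\{(1,2)\}$.
   Context: $S_n$ is the set of permutations of $[n]$ in one-line notation; a transposition $(i,j)$ acts by interchanging the entries $i$ and $j$. $\mathcal{P}^{\mathrm{all}}_n$ is the graph on $S_n$ whose edges join permutations differing by a transposition. A Gray code for $\mathcal{P}^{\mathrm{all}}_n$ is a listing $\pi_1,\dots,\pi_{n!}$ of all of $S_n$ where $\pi_{i+1}$ is obtained from $\pi_i$ by a transposition $t_i$; it is cyclic if $\pi_1$ is obtained from $\pi_{n!}$ by a transposition (the closing transposition), and a cyclic Gray code is balanced if, counting also the closing transposition, every transposition occurs exactly $2(n-2)!$ times. For a transposition $t$, $c^G_t$ is the number of $i\le n!-1$ with $t_i=t$ (closing transposition not counted), and $c_+(G)$ is the multiset containing each $t$ with $c^G_t<2(n-2)!$ with multiplicity $2(n-2)!-c^G_t$. -}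

module Defs where

open import Data.Nat using (ℕ; zero; suc; _+_; _*_; _∸_; _!)

open import Data.Fin using (Fin; zero; suc; fromℕ; inject₁; _<_; _≟_)
open import Data.Vec using (Vec; map; allFin; toList)
import Data.Vec.Properties as VecP
open import Data.List using (List; []; _∷_; _++_; [_]; head; last)
open import Data.List.Membership.Propositional using (_∈_)
open import Data.List.Relation.Unary.All using (All)
open import Data.List.Relation.Unary.Unique.Propositional using (Unique)
open import Data.List.Relation.Unary.Linked using (Linked)
open import Data.Maybe using (Maybe; just)
open import Data.Product using (Σ; _×_; ∃)
open import Relation.Nullary.Decidable using (does)
open import Data.Bool using (if_then_else_)
open import Relation.Binary.PropositionalEquality using (_≡_)
open import Relation.Nullary using (¬_)

-- One-line notation: a permutation of [n] is a vector of n entries from Fin n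
-- (entry k ∈ Fin n stands for the value k+1) with pairwise distinct entries.
Perm : ℕ → Set
Perm n = Vec (Fin n) n

IsPerm : ∀ {n} → Perm n → Set
IsPerm π = Unique (toList π)

idPerm : ∀ n → Perm n
idPerm n = allFin n

swapVal : ∀ {n} → Fin n → Fin n → Fin n → Fin n
swapVal i j x = if does (x ≟ i) then j else (if does (x ≟ j) then i else x)

act : ∀ {n} → Fin n → Fin n → Perm n → Perm n
act i j π = map (swapVal i j) π

Step : ∀ {n} → Perm n → Perm n → Set
Step {n} π π' = Σ (Fin n) λ i → Σ (Fin n) λ j → (i < j) × (act i j π ≡ π')

record IsGrayCode (n : ℕ) (G : List (Perm n)) : Set where
  field
    allPerm  : All IsPerm G
    distinct : Unique G
    complete : ∀ (π : Perm n) → IsPerm π → π ∈ G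
    steps    : Linked Step G

countT : ∀ {n} → Fin n → Fin n → List (Perm n) → ℕ
countT i j []           = 0
countT i j (x ∷ [])     = 0
countT i j (x ∷ y ∷ zs) =
  (if does (VecP.≡-dec _≟_ (act i j x) y) then 1 else 0) + countT i j (y ∷ zs)

-- c^G_t for t = (i,j): closing transposition not counted
cG : ∀ {n} → List (Perm n) → Fin n → Fin n → ℕ
cG G i j = countT i j G

-- A balanced cyclic Gray code for P^all_n with first element s and last element e
-- (n = m + 2, so 2 (n-2)! = 2 * m !).
record IsBalancedGC (m : ℕ) (s e : Perm (suc (suc m))) (G : List (Perm (suc (suc m)))) : Set where
  field
    gray     : IsGrayCode (suc (suc m)) G
    first    : head G ≡ just s
    final    : last G ≡ just e
    closing  : Step e s
    balanced : ∀ (i j : Fin (suc (suc m))) → i < j → countT i j (G ++ [ s ]) ≡ 2 * (m !)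

-- multiplicity of t = (i,j) in the multiset c_+(G): 2(n-2)! - c^G_t if positive, else 0
cPlus : (m : ℕ) → List (Perm (suc (suc m))) → Fin (suc (suc m)) → Fin (suc (suc m)) → ℕ
cPlus m G i j = 2 * (m !) ∸ cG G i j

CPlusSingleton : (m : ℕ) → List (Perm (suc (suc m))) → Fin (suc (suc m)) → Fin (suc (suc m)) → Set
CPlusSingleton m G a b =
  (cPlus m G a b ≡ 1) ×
  (∀ (i j : Fin (suc (suc m))) → i < j → ¬ ((i ≡ a) × (j ≡ b)) → cPlus m G i j ≡ 0)

tLastA tLastB : (m : ℕ) → Fin (suc (suc m))
tLastA m = inject₁ (fromℕ m)
tLastB m = fromℕ (suc m)

{-# OPTIONS --safe #-}
-- The reverse-complement map π ↦ w₀ π w₀ (reverse the one-line word and replace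
-- every entry k by n+1−k) is an involutive automorphism of P^all_n fixing the
-- identity; it turns a step by (i,j) into a step by (n+1−j, n+1−i). Applied
-- entrywise to G it therefore keeps the code Gray, cyclic and balanced, fixes
-- the first permutation, and sends the last one 1⋯n(n−1) and the deficient
-- transposition (n−1,n) to 21⋯n and (1,2).
module Submission where

open import Defs
open import Data.Nat using (ℕ; suc)
open import Data.Fin using (Fin; zero; suc)
open import Data.List using (List)
open import Data.Product using (Σ; _×_)

open import Data.Nat as ℕ using (s≤s; _∸_; _*_; _!)
open import Data.Nat.Properties using (∸-monoʳ-<)
open import Data.Fin using (opposite; fromℕ; inject₁; _≟_; _<_)
open import Data.Fin.Properties using (opposite-involutive; opposite-prop; toℕ<n)
open import Data.Vec as Vec using (tabulate; reverse; allFin; _∷ʳ_; toList)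
import Data.Vec.Properties as Vec
import Data.List as List
open import Data.List using ([]; _∷_; _++_; [_])
import Data.List.Properties as List
open import Data.List.Membership.Propositional using (_∈_)
open import Data.List.Membership.Propositional.Properties using (∈-map⁺)
import Data.List.Relation.Unary.All as All
import Data.List.Relation.Unary.All.Properties as All
open import Data.List.Relation.Unary.Unique.Propositional using (Unique)
import Data.List.Relation.Unary.Unique.Propositional.Properties as Unique
import Data.List.Relation.Unary.Linked as Linked
import Data.List.Relation.Unary.Linked.Properties as Linked
import Data.List.Relation.Binary.Permutation.Setoid.Properties as SetoidPermutation
import Data.Maybe as Maybe
open import Data.Product using (_,_)
open import Data.Bool using (if_then_else_)
open import Data.Bool.Properties using (if-float)
open import Function using (_∘_; id; mk⇔)
open import Function.Definitions using (Injective)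
open import Relation.Nullary using (yes; no; does)
open import Relation.Nullary.Decidable using (does-⇔)
open import Relation.Binary.PropositionalEquality hiding ([_])
open ≡-Reasoning

private variable
  n : ℕ

opposite-transpose : {i j : Fin n} → opposite i ≡ j → i ≡ opposite j
opposite-transpose {i = i} refl = sym (opposite-involutive i)

opposite-injective : Injective {A = Fin n} _≡_ _≡_ opposite
opposite-injective {y = j} eq = trans (opposite-transpose eq) (opposite-involutive j)

opposite-< : {i j : Fin n} → i < j → opposite j < opposite i
opposite-< {suc n} {i} {j} i<j rewrite opposite-prop i | opposite-prop j =
  ∸-monoʳ-< (s≤s i<j) (toℕ<n j)

tabulate-∷ʳ : {A : Set} (g : Fin (suc n) → A) →
              tabulate g ≡ tabulate (g ∘ inject₁) ∷ʳ g (fromℕ n)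
tabulate-∷ʳ {n = ℕ.zero}  g = refl
tabulate-∷ʳ {n = ℕ.suc n} g = cong (g zero Vec.∷_) (tabulate-∷ʳ (g ∘ suc))

swapVal-comm : (i j : Fin n) → swapVal i j ≗ swapVal j i
swapVal-comm i j x with x ≟ i | x ≟ j
... | yes x≡i | yes x≡j = trans (sym x≡j) x≡i
... | yes _   | no _    = refl
... | no _    | yes _   = refl
... | no _    | no _    = refl

act-comm : (i j : Fin n) → act i j ≗ act j i
act-comm i j = Vec.map-cong (swapVal-comm i j)

swapVal-relabel : {g : Fin n → Fin n} → Injective _≡_ _≡_ g → ∀ i j x →
                  g (swapVal i j x) ≡ swapVal (g i) (g j) (g x)
swapVal-relabel {g = g} g-inj i j x = begin
  g (swapVal i j x)
    ≡⟨ if-float g (does (x ≟ i)) ⟩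
  (if does (x ≟ i) then g j else g (if does (x ≟ j) then i else x))
    ≡⟨ cong (if does (x ≟ i) then g j else_) (if-float g (does (x ≟ j))) ⟩
  (if does (x ≟ i) then g j else (if does (x ≟ j) then g i else g x))
    ≡⟨ cong₂ (λ b c → if b then g j else (if c then g i else g x)) (same-test i) (same-test j) ⟩
  swapVal (g i) (g j) (g x) ∎
  where
  same-test : ∀ k → does (x ≟ k) ≡ does (g x ≟ g k)
  same-test k = does-⇔ (mk⇔ (cong g) g-inj) (x ≟ k) (g x ≟ g k)

act-relabel : {g : Fin n → Fin n} → Injective _≡_ _≡_ g → ∀ i j (π : Perm n) →
              Vec.map g (act i j π) ≡ act (g i) (g j) (Vec.map g π)
act-relabel {g = g} g-inj i j π = begin
  Vec.map g (Vec.map (swapVal i j) π)              ≡⟨ Vec.map-∘ g (swapVal i j) π ⟨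
  Vec.map (g ∘ swapVal i j) π                      ≡⟨ Vec.map-cong (swapVal-relabel g-inj i j) π ⟩
  Vec.map (swapVal (g i) (g j) ∘ g) π              ≡⟨ Vec.map-∘ (swapVal (g i) (g j)) g π ⟩
  Vec.map (swapVal (g i) (g j)) (Vec.map g π)      ∎

unique-reverse : {A : Set} {xs : List A} → Unique xs → Unique (List.reverse xs)
unique-reverse {A = A} {xs} = Unique-resp-↭ (↭-sym (↭-reverse xs))
  where open SetoidPermutation (setoid A)
        open import Data.List.Relation.Binary.Permutation.Setoid (setoid A) using (↭-sym)

reverseComplement : Perm n → Perm n
reverseComplement π = Vec.map opposite (reverse π)

reverseComplement-involutive : (π : Perm n) → reverseComplement (reverseComplement π) ≡ π
reverseComplement-involutive π = begin
  Vec.map opposite (reverse (Vec.map opposite (reverse π)))  ≡⟨ cong (Vec.map opposite) (Vec.map-reverse opposite (reverse π)) ⟨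
  Vec.map opposite (Vec.map opposite (reverse (reverse π)))  ≡⟨ Vec.map-∘ opposite opposite _ ⟨
  Vec.map (opposite ∘ opposite) (reverse (reverse π))        ≡⟨ Vec.map-cong opposite-involutive _ ⟩
  Vec.map id (reverse (reverse π))                           ≡⟨ Vec.map-id _ ⟩
  reverse (reverse π)                                        ≡⟨ Vec.reverse-involutive π ⟩
  π                                                          ∎

reverseComplement-injective : Injective {A = Perm n} _≡_ _≡_ reverseComplement
reverseComplement-injective {x = π} {ρ} eq = begin
  π                                          ≡⟨ reverseComplement-involutive π ⟨
  reverseComplement (reverseComplement π)    ≡⟨ cong reverseComplement eq ⟩
  reverseComplement (reverseComplement ρ)    ≡⟨ reverseComplement-involutive ρ ⟩
  ρ                                          ∎

reverseComplement-act : ∀ i j (π : Perm n) →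
  reverseComplement (act i j π) ≡ act (opposite i) (opposite j) (reverseComplement π)
reverseComplement-act i j π = begin
  Vec.map opposite (reverse (act i j π))              ≡⟨ cong (Vec.map opposite) (Vec.map-reverse (swapVal i j) π) ⟨
  Vec.map opposite (act i j (reverse π))              ≡⟨ act-relabel opposite-injective i j (reverse π) ⟩
  act (opposite i) (opposite j) (reverseComplement π) ∎

reverseComplement-idPerm : ∀ n → reverseComplement (idPerm n) ≡ idPerm n
reverseComplement-idPerm ℕ.zero    = refl
reverseComplement-idPerm (ℕ.suc n) = begin
  reverseComplement (allFin (suc n))
    ≡⟨ cong reverseComplement (Vec.allFin-map n) ⟩
  Vec.map opposite (reverse (zero Vec.∷ Vec.map suc (allFin n)))
    ≡⟨ cong (Vec.map opposite) (Vec.reverse-∷ zero (Vec.map suc (allFin n))) ⟩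
  Vec.map opposite (reverse (Vec.map suc (allFin n)) ∷ʳ zero)
    ≡⟨ Vec.map-∷ʳ opposite zero _ ⟩
  Vec.map opposite (reverse (Vec.map suc (allFin n))) ∷ʳ fromℕ n
    ≡⟨ cong (λ v → Vec.map opposite v ∷ʳ fromℕ n) (Vec.map-reverse suc (allFin n)) ⟨
  Vec.map opposite (Vec.map suc (reverse (allFin n))) ∷ʳ fromℕ n
    ≡⟨ cong (_∷ʳ fromℕ n) (Vec.map-∘ opposite suc _) ⟨
  Vec.map (inject₁ ∘ opposite) (reverse (allFin n)) ∷ʳ fromℕ n
    ≡⟨ cong (_∷ʳ fromℕ n) (Vec.map-∘ inject₁ opposite _) ⟩
  Vec.map inject₁ (reverseComplement (allFin n)) ∷ʳ fromℕ n
    ≡⟨ cong (λ v → Vec.map inject₁ v ∷ʳ fromℕ n) (reverseComplement-idPerm n) ⟩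
  Vec.map inject₁ (allFin n) ∷ʳ fromℕ n
    ≡⟨ cong (_∷ʳ fromℕ n) (Vec.tabulate-allFin inject₁) ⟨
  tabulate inject₁ ∷ʳ fromℕ n
    ≡⟨ tabulate-∷ʳ id ⟨
  allFin (suc n) ∎

reverseComplement-isPerm : {π : Perm n} → IsPerm π → IsPerm (reverseComplement π)
reverseComplement-isPerm {π = π} π-perm =
  subst Unique (sym toList-reverseComplement)
        (Unique.map⁺ opposite-injective (unique-reverse π-perm))
  where
  toList-reverseComplement : toList (reverseComplement π) ≡ List.map opposite (List.reverse (toList π))
  toList-reverseComplement = trans (Vec.toList-map opposite (reverse π))
                                   (cong (List.map opposite) (Vec.toList-reverse π))

reverseComplement-step : {π ρ : Perm n} → Step π ρ → Step (reverseComplement π) (reverseComplement ρ)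
reverseComplement-step {π = π} (i , j , i<j , refl) =
  opposite j , opposite i , opposite-< i<j ,
  trans (act-comm (opposite j) (opposite i) (reverseComplement π)) (sym (reverseComplement-act i j π))

countT-map : {Φ : Perm n → Perm n} → Injective _≡_ _≡_ Φ →
             ∀ {i j i′ j′} → (∀ π → act i j (Φ π) ≡ Φ (act i′ j′ π)) →
             ∀ πs → countT i j (List.map Φ πs) ≡ countT i′ j′ πs
countT-map Φ-inj commute []           = refl
countT-map Φ-inj commute (x ∷ [])     = refl
countT-map {Φ = Φ} Φ-inj {i} {j} {i′} {j′} commute (x ∷ y ∷ zs) =
  cong₂ ℕ._+_ (cong (λ b → if b then 1 else 0) same-test) (countT-map Φ-inj commute (y ∷ zs))
  where
  same-test : does (Vec.≡-dec _≟_ (act i j (Φ x)) (Φ y)) ≡ does (Vec.≡-dec _≟_ (act i′ j′ x) y)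
  same-test rewrite commute x =
    does-⇔ (mk⇔ Φ-inj (cong Φ)) (Vec.≡-dec _≟_ (Φ (act i′ j′ x)) (Φ y)) (Vec.≡-dec _≟_ (act i′ j′ x) y)

countT-reverseComplement : (i j : Fin n) (πs : List (Perm n)) →
  countT i j (List.map reverseComplement πs) ≡ countT (opposite j) (opposite i) πs
countT-reverseComplement i j = countT-map reverseComplement-injective commute
  where
  commute : ∀ π → act i j (reverseComplement π) ≡ reverseComplement (act (opposite j) (opposite i) π)
  commute π = sym (begin
    reverseComplement (act (opposite j) (opposite i) π)
      ≡⟨ reverseComplement-act (opposite j) (opposite i) π ⟩
    act (opposite (opposite j)) (opposite (opposite i)) (reverseComplement π)
      ≡⟨ cong₂ (λ a b → act a b (reverseComplement π)) (opposite-involutive j) (opposite-involutive i) ⟩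
    act j i (reverseComplement π)
      ≡⟨ act-comm j i (reverseComplement π) ⟩
    act i j (reverseComplement π) ∎)

isGrayCode-reverseComplement : {G : List (Perm n)} → IsGrayCode n G →
                               IsGrayCode n (List.map reverseComplement G)
isGrayCode-reverseComplement {G = G} gray = record
  { allPerm  = All.map⁺ (All.map reverseComplement-isPerm allPerm)
  ; distinct = Unique.map⁺ reverseComplement-injective distinct
  ; complete = λ π π-perm → subst (_∈ List.map reverseComplement G) (reverseComplement-involutive π)
                 (∈-map⁺ reverseComplement (complete (reverseComplement π) (reverseComplement-isPerm π-perm)))
  ; steps    = Linked.map⁺ (Linked.map reverseComplement-step steps)
  }
  where open IsGrayCode gray

isBalancedGC-reverseComplement : ∀ {m s e G} → IsBalancedGC m s e G →
  IsBalancedGC m (reverseComplement s) (reverseComplement e) (List.map reverseComplement G)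
isBalancedGC-reverseComplement {m} {s} {e} {G} balancedGC = record
  { gray     = isGrayCode-reverseComplement gray
  ; first    = trans (List.head-map G) (cong (Maybe.map reverseComplement) first)
  ; final    = trans (List.last-map reverseComplement G) (cong (Maybe.map reverseComplement) final)
  ; closing  = reverseComplement-step closing
  ; balanced = λ i j i<j → begin
      countT i j (List.map reverseComplement G ++ [ reverseComplement s ])
        ≡⟨ cong (countT i j) (List.map-++ reverseComplement G [ s ]) ⟨
      countT i j (List.map reverseComplement (G ++ [ s ]))
        ≡⟨ countT-reverseComplement i j (G ++ [ s ]) ⟩
      countT (opposite j) (opposite i) (G ++ [ s ])
        ≡⟨ balanced (opposite j) (opposite i) (opposite-< i<j) ⟩
      2 * m ! ∎
  }
  where open IsBalancedGC balancedGC

cPlus-reverseComplement : ∀ m G (i j : Fin (suc (suc m))) →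
  cPlus m (List.map reverseComplement G) i j ≡ cPlus m G (opposite j) (opposite i)
cPlus-reverseComplement m G i j = cong (2 * m ! ∸_) (countT-reverseComplement i j G)

cPlusSingleton-reverseComplement : ∀ {m G a b} → CPlusSingleton m G a b →
  CPlusSingleton m (List.map reverseComplement G) (opposite b) (opposite a)
cPlusSingleton-reverseComplement {m} {G} {a} {b} (deficient , others) =
  trans (cPlus-reverseComplement m G (opposite b) (opposite a))
        (trans (cong₂ (cPlus m G) (opposite-involutive a) (opposite-involutive b)) deficient) ,
  λ i j i<j not-ba → trans (cPlus-reverseComplement m G i j)
    (others (opposite j) (opposite i) (opposite-< i<j)
            (λ (j≡a , i≡b) → not-ba (opposite-transpose i≡b , opposite-transpose j≡a)))

lemma4p4 : (m : ℕ) → (G : List (Perm (suc (suc m)))) →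
    IsBalancedGC m (idPerm (suc (suc m))) (act (tLastA m) (tLastB m) (idPerm (suc (suc m)))) G →
    CPlusSingleton m G (tLastA m) (tLastB m) →
    Σ (List (Perm (suc (suc m)))) λ H →
      IsBalancedGC m (idPerm (suc (suc m))) (act zero (suc zero) (idPerm (suc (suc m)))) H ×
      CPlusSingleton m H zero (suc zero)
lemma4p4 m G balancedGC cPlusSingleton =
  H ,
  subst₂ (λ s e → IsBalancedGC m s e H) (reverseComplement-idPerm _) reverseComplement-swapLastTwo
         (isBalancedGC-reverseComplement balancedGC) ,
  subst₂ (CPlusSingleton m H) (opposite-involutive zero) (opposite-involutive (suc zero))
         (cPlusSingleton-reverseComplement {G = G} cPlusSingleton)
  where
  H : List (Perm (suc (suc m)))
  H = List.map reverseComplement G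
  ι : Perm (suc (suc m))
  ι = idPerm (suc (suc m))
  -- tLastA m and tLastB m are, by definition, opposite (suc zero) and opposite zero.
  reverseComplement-swapLastTwo : reverseComplement (act (tLastA m) (tLastB m) ι) ≡ act zero (suc zero) ι
  reverseComplement-swapLastTwo = begin
    reverseComplement (act (opposite (suc zero)) (opposite zero) ι)
      ≡⟨ reverseComplement-act (opposite (suc zero)) (opposite zero) ι ⟩
    act (opposite (opposite (suc zero))) (opposite (opposite zero)) (reverseComplement ι)
      ≡⟨ cong₂ (λ i j → act i j (reverseComplement ι)) (opposite-involutive (suc zero)) (opposite-involutive zero) ⟩
    act (suc zero) zero (reverseComplement ι)
      ≡⟨ cong (act (suc zero) zero) (reverseComplement-idPerm _) ⟩
    act (suc zero) zero ι
      ≡⟨ act-comm (suc zero) zero ι ⟩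
    act zero (suc zero) ι ∎
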